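{- Let $m,n$ be integers with $2\le m<n$. Then: (1) $D_{\max}(K_{m,n})=\chi'_{D,\max}(K_{m,n})=n$, $D'_{\max}(K_{m,n})=D'(K_{m,n})$, and $\chi_{D,\max}(K_{m,n})=m+n$. (2) If $K_{m,n}$ admits a rigid orientation, then $D_{\min}(K_{m,n})=D'_{\min}(K_{m,n})=1$, $\chi_{D,\min}(K_{m,n})=2$ and $\chi'_{D,\min}(K_{m,n})=n$. (3) If $K_{m,n}$ does not admit any rigid orientation, then $D_{\min}(K_{m,n})\le \lceil n/(m-1)\rceil$, $\chi_{D,\min}(K_{m,n})\le 1+\lceil n/(m-1)\rceil$, $D'_{\min}(K_{m,n})\le D'(K_{m,\lceil n/(m-1)\rceil})$, and $\chi'_{D,\min}(K_{m,n})=n$.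
   Context: $K_{m,n}$ is the complete bipartite graph with parts of sizes $m$ and $n$. An orientation of a simple graph assigns one direction to each edge. An automorphism of an undirected graph is a vertex permutation preserving edges; an automorphism of an oriented graph is a permutation $\phi$ of its vertices such that $\phi(u)\phi(v)$ is an arc whenever $uv$ is an arc. A graph or oriented graph is rigid if its only automorphism is the identity. An $r$-vertex-labelling maps vertices to $\{1,\dots,r\}$, an $r$-edge-labelling ($r$-arc-labelling) maps edges (arcs) to $\{1,\dots,r\}$; colourings are proper labellings (adjacent vertices, resp. edges/arcs sharing an end-vertex, get distinct labels). A labelling $\lambda$ is distinguishing if the only automorphism $\phi$ with $\lambda(\phi(u))=\lambda(u)$ for all vertices (resp. $\lambda(\phi(u)\phi(v))=\lambda(uv)$ for all edges/arcs) is the identity. For an undirected graph $G$, $D'(G)$ is the least $r$ such that $G$ admits a distinguishing $r$-edge-labelling. For an oriented graph $\vec G$, $D(\vec G)$, $\chi_D(\vec G)$, $D'(\vec G)$, $\chi'_D(\vec G)$ are the least $r$ for which $\vec G$ admits a distinguishing $r$-vertex-labelling, $r$-vertex-colouring, $r$-arc-labelling, $r$-arc-colouring. For an undirected graph $G$, $D_{\min}(G)$ and $D_{\max}(G)$ are the minimum and maximum of $D(\vec G)$ over all orientations $\vec G$ of $G$; analogously $\chi_{D,\min},\chi_{D,\max}$ for $\chi_D$, $D'_{\min},D'_{\max}$ for $D'$, and $\chi'_{D,\min},\chi'_{D,\max}$ for $\chi'_D$. -}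

module Defs where

open import Data.Nat using (ℕ; zero; suc; _+_; _∸_; _<_; _≤_)
open import Data.Nat.DivMod using (_/_)
open import Data.Fin using (Fin)
open import Data.Sum using (_⊎_; inj₁; inj₂)
open import Data.Bool using (Bool; true; false)
open import Data.Maybe using (Maybe; just; nothing)
open import Data.Product using (Σ; _×_)
open import Data.Unit using (⊤)
open import Data.Empty using (⊥)
open import Relation.Nullary using (¬_)
open import Relation.Binary.PropositionalEquality using (_≡_; _≢_)
open import Function.Bundles using (_↔_; Inverse)

V : ℕ → ℕ → Set
V m n = Fin m ⊎ Fin n

Edge : ∀ {m n} → V m n → V m n → Set
Edge (inj₁ _) (inj₂ _) = ⊤
Edge (inj₂ _) (inj₁ _) = ⊤
Edge _ _ = ⊥

-- An orientation of K_{m,n}: o i j = true means arc (left i) → (right j),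
-- false means arc (right j) → (left i).
Orientation : ℕ → ℕ → Set
Orientation m n = Fin m → Fin n → Bool

Arc : ∀ {m n} → Orientation m n → V m n → V m n → Set
Arc o (inj₁ i) (inj₂ j) = o i j ≡ true
Arc o (inj₂ j) (inj₁ i) = o i j ≡ false
Arc o _ _ = ⊥

Perm : ℕ → ℕ → Set
Perm m n = V m n ↔ V m n

app : ∀ {m n} → Perm m n → V m n → V m n
app φ = Inverse.to φ

IsIdentity : ∀ {m n} → Perm m n → Set
IsIdentity φ = ∀ u → app φ u ≡ u

IsUAut : ∀ {m n} → Perm m n → Set
IsUAut φ = ∀ u v → Edge u v → Edge (app φ u) (app φ v)

IsOAut : ∀ {m n} → Orientation m n → Perm m n → Set
IsOAut o φ = ∀ u v → Arc o u v → Arc o (app φ u) (app φ v)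

Rigid : ∀ {m n} → Orientation m n → Set
Rigid o = ∀ φ → IsOAut o φ → IsIdentity φ

-- Edge/arc labellings: each edge {left i, right j} of K_{m,n} carries exactly
-- one arc in any orientation, so an r-edge-labelling (r-arc-labelling) is a
-- function Fin m → Fin n → Fin r.  lab ℓ u v is the label of the edge uv.
EdgeLab : ℕ → ℕ → ℕ → Set
EdgeLab m n r = Fin m → Fin n → Fin r

lab : ∀ {m n r} → EdgeLab m n r → V m n → V m n → Maybe (Fin r)
lab ℓ (inj₁ i) (inj₂ j) = just (ℓ i j)
lab ℓ (inj₂ j) (inj₁ i) = just (ℓ i j)
lab ℓ _ _ = nothing

ProperEdgeCol : ∀ {m n r} → EdgeLab m n r → Set
ProperEdgeCol {m} {n} ℓ =
  (∀ (i : Fin m) (j j' : Fin n) → j ≢ j' → ℓ i j ≢ ℓ i j') ×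
  (∀ (i i' : Fin m) (j : Fin n) → i ≢ i' → ℓ i j ≢ ℓ i' j)

VDist : ∀ {m n r} → Orientation m n → (V m n → Fin r) → Set
VDist o c = ∀ φ → IsOAut o φ → (∀ u → c (app φ u) ≡ c u) → IsIdentity φ

ProperVCol : ∀ {m n r} → Orientation m n → (V m n → Fin r) → Set
ProperVCol o c = ∀ u v → Arc o u v → c u ≢ c v

ADist : ∀ {m n r} → Orientation m n → EdgeLab m n r → Set
ADist o ℓ = ∀ φ → IsOAut o φ →
  (∀ u v → Arc o u v → lab ℓ (app φ u) (app φ v) ≡ lab ℓ u v) → IsIdentity φ

UDist : ∀ {m n r} → EdgeLab m n r → Set
UDist ℓ = ∀ φ → IsUAut φ →
  (∀ u v → Edge u v → lab ℓ (app φ u) (app φ v) ≡ lab ℓ u v) → IsIdentity φ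

HasD : ∀ {m n} → Orientation m n → ℕ → Set
HasD {m} {n} o r = Σ (V m n → Fin r) (λ c → VDist o c)

HasχD : ∀ {m n} → Orientation m n → ℕ → Set
HasχD {m} {n} o r = Σ (V m n → Fin r) (λ c → ProperVCol o c × VDist o c)

HasD' : ∀ {m n} → Orientation m n → ℕ → Set
HasD' {m} {n} o r = Σ (EdgeLab m n r) (λ ℓ → ADist o ℓ)

Hasχ'D : ∀ {m n} → Orientation m n → ℕ → Set
Hasχ'D {m} {n} o r = Σ (EdgeLab m n r) (λ ℓ → ProperEdgeCol ℓ × ADist o ℓ)

HasUD' : ℕ → ℕ → ℕ → Set
HasUD' m n r = Σ (EdgeLab m n r) (λ ℓ → UDist ℓ)

IsLeast : (ℕ → Set) → ℕ → Set
IsLeast P k = P k × (∀ r → r < k → ¬ P r)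

MaxOver : ∀ {m n} → (Orientation m n → ℕ → Set) → ℕ → Set
MaxOver {m} {n} P k =
  Σ (Orientation m n) (λ o → IsLeast (P o) k) ×
  (∀ (o : Orientation m n) k' → IsLeast (P o) k' → k' ≤ k)

MinOver : ∀ {m n} → (Orientation m n → ℕ → Set) → ℕ → Set
MinOver {m} {n} P k =
  Σ (Orientation m n) (λ o → IsLeast (P o) k) ×
  (∀ (o : Orientation m n) k' → IsLeast (P o) k' → k ≤ k')

MinAtMost : ∀ {m n} → (Orientation m n → ℕ → Set) → ℕ → Set
MinAtMost {m} {n} P k =
  Σ (Orientation m n) (λ o → Σ ℕ (λ k' → IsLeast (P o) k' × k' ≤ k))

-- ⌈ n / (m - 1) ⌉ for m ≥ 2, computed as (n + (m-2)) / (m-1).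
ceilDivPred : ℕ → ℕ → ℕ
ceilDivPred n m = (n + (m ∸ 2)) / suc (m ∸ 2)

module Submission where

-- As m < n, every automorphism of K_{m,n} (or of an orientation) preserves the two parts,
-- by the pigeonhole principle, so it acts as a pair (σ, τ) of maps of the parts.  Bounds
-- valid for all orientations: n labels for D (each part labelled injectively), m + n
-- colours for χ_D, and the cyclic colouring (i + j) mod n for χ'_D, which is proper and
-- fixed by no non-trivial (σ, τ); properness at one left vertex gives χ'_D ≥ n.  The
-- forward orientation (all arcs left to right) attains the maxima: transposing two vertices
-- of a part is one of its automorphisms, so a distinguishing labelling separates each part;
-- and its automorphisms are those of K_{m,n}, so its D' is D'(K_{m,n}).  For the minima a
-- rigid orientation makes every labelling distinguishing, and in general the staircase
-- orientation (i → j iff i ≤ j mod (m − 1)) only admits automorphisms fixing the left part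
-- and the residue of every right vertex, so labelling right vertices by j div (m − 1)
-- suffices.  Least values exist since having a distinguishing labelling with r labels is
-- decidable by exhaustive search.

open import Defs
open import Data.Nat using (ℕ; zero; suc; _+_; _*_; _≤_; _<_; z≤n; s≤s; _≤ᵇ_)
open import Data.Nat.Properties
open import Data.Nat.DivMod
open import Data.Fin as F using (Fin; zero; suc; toℕ; fromℕ<)
import Data.Fin.Properties as FP
import Data.Fin.Induction as FPI
import Data.Fin.Permutation.Components as PC
open import Data.Fin.Permutation using (Permutation′; _⟨$⟩ʳ_; _⟨$⟩ˡ_; inverseˡ; inverseʳ; transpose)
  renaming (id to idₚ)
open import Data.Sum as Sum using (_⊎_; inj₁; inj₂)
open import Data.Sum.Properties as SP using (inj₁-injective; inj₂-injective)
open import Data.Product using (Σ; _×_; _,_; proj₁; proj₂)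
open import Data.Bool using (true; false; T)
open import Data.Bool.Properties as BP using (T-≡)
open import Data.Maybe using (just)
import Data.Maybe.Properties as MP
open import Data.Vec using (Vec; []; _∷_; lookup; tabulate)
open import Data.Vec.Properties using (lookup∘tabulate)
open import Data.Unit using (tt)
open import Data.Empty using (⊥-elim)
open import Relation.Nullary using (¬_; Dec; yes; no)
open import Relation.Nullary.Decidable using (dec-true; map′; ¬?; decidable-stable; _×-dec_; _→-dec_)
open import Relation.Binary.PropositionalEquality
open import Function.Bundles using (Inverse; Equivalence; mk↔ₛ′)

arc⇒edge : ∀ {m n} (o : Orientation m n) u v → Arc o u v → Edge u v
arc⇒edge o (inj₁ i) (inj₂ j) _ = tt
arc⇒edge o (inj₂ j) (inj₁ i) _ = tt

edge⇒arc : ∀ {m n} (o : Orientation m n) u v → Edge u v → Arc o u v ⊎ Arc o v u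
edge⇒arc o (inj₁ i) (inj₂ j) _ with o i j
... | true = inj₁ refl
... | false = inj₂ refl
edge⇒arc o (inj₂ j) (inj₁ i) _ with o i j
... | true = inj₂ refl
... | false = inj₁ refl

edge-sym : ∀ {m n} (u v : V m n) → Edge u v → Edge v u
edge-sym (inj₁ i) (inj₂ j) _ = tt
edge-sym (inj₂ j) (inj₁ i) _ = tt

lab-sym : ∀ {m n r} (ℓ : EdgeLab m n r) u v → lab ℓ u v ≡ lab ℓ v u
lab-sym ℓ (inj₁ i) (inj₁ i') = refl
lab-sym ℓ (inj₁ i) (inj₂ j) = refl
lab-sym ℓ (inj₂ j) (inj₁ i) = refl
lab-sym ℓ (inj₂ j) (inj₂ j') = refl

oaut⇒uaut : ∀ {m n} (o : Orientation m n) (φ : Perm m n) → IsOAut o φ → IsUAut φ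
oaut⇒uaut o φ aut u v e with edge⇒arc o u v e
... | inj₁ a = arc⇒edge o _ _ (aut u v a)
... | inj₂ a = edge-sym _ _ (arc⇒edge o _ _ (aut v u a))

arcLabels⇒edgeLabels : ∀ {m n r} (o : Orientation m n) (ℓ : EdgeLab m n r) (φ : Perm m n) →
  (∀ u v → Arc o u v → lab ℓ (app φ u) (app φ v) ≡ lab ℓ u v) →
  (∀ u v → Edge u v → lab ℓ (app φ u) (app φ v) ≡ lab ℓ u v)
arcLabels⇒edgeLabels o ℓ φ arcPres u v e with edge⇒arc o u v e
... | inj₁ a = arcPres u v a
... | inj₂ a = trans (lab-sym ℓ (app φ u) (app φ v)) (trans (arcPres v u a) (lab-sym ℓ v u))

UDist⇒ADist : ∀ {m n r} (o : Orientation m n) (ℓ : EdgeLab m n r) → UDist ℓ → ADist o ℓ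
UDist⇒ADist o ℓ ud φ aut arcPres = ud φ (oaut⇒uaut o φ aut) (arcLabels⇒edgeLabels o ℓ φ arcPres)

app-injective : ∀ {m n} (φ : Perm m n) {u v} → app φ u ≡ app φ v → u ≡ v
app-injective φ {u} {v} e = begin
  u                            ≡⟨ Inverse.strictlyInverseʳ φ u ⟨
  Inverse.from φ (app φ u)     ≡⟨ cong (Inverse.from φ) e ⟩
  Inverse.from φ (app φ v)     ≡⟨ Inverse.strictlyInverseʳ φ v ⟩
  v                            ∎
  where open ≡-Reasoning

leftNeighbour : ∀ {m n} {j : Fin n} (x : V m n) → Edge (inj₂ j) x → Σ (Fin m) λ i → x ≡ inj₁ i
leftNeighbour (inj₁ i) _ = i , refl

-- When m < n, an automorphism φ of K_{m,n} preserves both parts, so it acts as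
-- a pair of permutations σ (on the left) and τ (on the right).
module Sides {m n : ℕ} (m<n : m < n) (φ : Perm m n) (aut : IsUAut φ) where

  -- If φ mapped a left vertex to the right, it would map every right vertex
  -- (all being adjacent to it) to the left ...
  rightToLeft : ∀ {i j} → app φ (inj₁ i) ≡ inj₂ j → ∀ j' → Σ (Fin m) λ i' → app φ (inj₂ j') ≡ inj₁ i'
  rightToLeft {i} eq j' =
    leftNeighbour _ (subst (λ y → Edge y (app φ (inj₂ j'))) eq (aut (inj₁ i) (inj₂ j') tt))

  -- ... which the pigeonhole principle forbids, as m < n.
  notRightToLeft : ¬ (∀ j → Σ (Fin m) λ i → app φ (inj₂ j) ≡ inj₁ i)
  notRightToLeft image with FP.pigeonhole m<n (λ j → proj₁ (image j))
  ... | a , b , a<b , e = FP.<⇒≢ a<b (inj₂-injective (app-injective φ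
        (trans (proj₂ (image a)) (trans (cong inj₁ e) (sym (proj₂ (image b)))))))

  leftToLeft : ∀ i → Σ (Fin m) λ i' → app φ (inj₁ i) ≡ inj₁ i'
  leftToLeft i with app φ (inj₁ i) in eq
  ... | inj₁ i' = i' , refl
  ... | inj₂ j = ⊥-elim (notRightToLeft (rightToLeft eq))

  -- A right vertex mapped to the left would be adjacent to the image of a left
  -- vertex, which lies on the left as well.
  rightToRight : ∀ j → Σ (Fin n) λ j' → app φ (inj₂ j) ≡ inj₂ j'
  rightToRight j with app φ (inj₂ j) in eq
  ... | inj₂ j' = j' , refl
  ... | inj₁ i = ⊥-elim (subst₂ Edge (proj₂ (leftToLeft i)) eq (aut (inj₁ i) (inj₂ j) tt))

  σ : Fin m → Fin m
  σ i = proj₁ (leftToLeft i)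

  τ : Fin n → Fin n
  τ j = proj₁ (rightToRight j)

  φ-left : ∀ i → app φ (inj₁ i) ≡ inj₁ (σ i)
  φ-left i = proj₂ (leftToLeft i)

  φ-right : ∀ j → app φ (inj₂ j) ≡ inj₂ (τ j)
  φ-right j = proj₂ (rightToRight j)

  identity : (∀ i → σ i ≡ i) → (∀ j → τ j ≡ j) → IsIdentity φ
  identity σ-id τ-id (inj₁ i) = trans (φ-left i) (cong inj₁ (σ-id i))
  identity σ-id τ-id (inj₂ j) = trans (φ-right j) (cong inj₂ (τ-id j))

  edgeLabels : ∀ {r} (ℓ : EdgeLab m n r) → (∀ u v → Edge u v → lab ℓ (app φ u) (app φ v) ≡ lab ℓ u v) →
               ∀ i j → ℓ (σ i) (τ j) ≡ ℓ i j
  edgeLabels ℓ pres i j =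
    MP.just-injective (trans (sym (cong₂ (lab ℓ) (φ-left i) (φ-right j))) (pres (inj₁ i) (inj₂ j) tt))

module OrientedSides {m n : ℕ} (m<n : m < n) (o : Orientation m n) (φ : Perm m n) (aut : IsOAut o φ) where
  open Sides m<n φ (oaut⇒uaut o φ aut) public

  direction : ∀ i j → o (σ i) (τ j) ≡ o i j
  direction i j with o i j in e
  ... | true = subst₂ (Arc o) (φ-left i) (φ-right j) (aut (inj₁ i) (inj₂ j) e)
  ... | false = subst₂ (Arc o) (φ-right j) (φ-left i) (aut (inj₂ j) (inj₁ i) e)

  arcLabels : ∀ {r} (ℓ : EdgeLab m n r) → (∀ u v → Arc o u v → lab ℓ (app φ u) (app φ v) ≡ lab ℓ u v) →
              ∀ i j → ℓ (σ i) (τ j) ≡ ℓ i j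
  arcLabels ℓ pres = edgeLabels ℓ (arcLabels⇒edgeLabels o ℓ φ pres)

forward : ∀ {m n} → Orientation m n
forward _ _ = true

-- When m < n every automorphism of K_{m,n} preserves the parts, hence is an
-- automorphism of the forward orientation; so a distinguishing arc-labelling of
-- the forward orientation is a distinguishing edge-labelling of K_{m,n}.
ADist-forward⇒UDist : ∀ {m n r} → m < n → (ℓ : EdgeLab m n r) → ADist forward ℓ → UDist ℓ
ADist-forward⇒UDist {m} {n} m<n ℓ ad φ uaut pres =
  ad φ forwardAut (λ u v a → pres u v (arc⇒edge forward u v a))
  where
  open Sides m<n φ uaut
  forwardAut : IsOAut forward φ
  forwardAut (inj₁ i) (inj₂ j) _ = subst₂ (Arc forward) (sym (φ-left i)) (sym (φ-right j)) refl
  forwardAut (inj₂ j) (inj₁ i) ()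

transpose-invariant : ∀ {k} {X : Set} (h : Fin k → X) {a b} → h a ≡ h b → ∀ x → h (PC.transpose a b x) ≡ h x
transpose-invariant h {a} {b} e x with x F.≟ a
... | yes refl = sym e
... | no _ with x F.≟ b
... | yes refl = e
... | no _ = refl

transpose-moves : ∀ {k} (a b : Fin k) → PC.transpose a b a ≡ b
transpose-moves a b rewrite dec-true (a F.≟ a) refl = refl

sidewise : ∀ {m n} → Permutation′ m → Permutation′ n → Perm m n
sidewise π ρ = mk↔ₛ′ (Sum.map (π ⟨$⟩ʳ_) (ρ ⟨$⟩ʳ_)) (Sum.map (π ⟨$⟩ˡ_) (ρ ⟨$⟩ˡ_)) toFrom fromTo
  where
  toFrom : ∀ u → Sum.map (π ⟨$⟩ʳ_) (ρ ⟨$⟩ʳ_) (Sum.map (π ⟨$⟩ˡ_) (ρ ⟨$⟩ˡ_) u) ≡ u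
  toFrom (inj₁ i) = cong inj₁ (inverseʳ π)
  toFrom (inj₂ j) = cong inj₂ (inverseʳ ρ)
  fromTo : ∀ u → Sum.map (π ⟨$⟩ˡ_) (ρ ⟨$⟩ˡ_) (Sum.map (π ⟨$⟩ʳ_) (ρ ⟨$⟩ʳ_) u) ≡ u
  fromTo (inj₁ i) = cong inj₁ (inverseˡ π)
  fromTo (inj₂ j) = cong inj₂ (inverseˡ ρ)

sidewise-forward : ∀ {m n} (π : Permutation′ m) (ρ : Permutation′ n) → IsOAut forward (sidewise π ρ)
sidewise-forward π ρ (inj₁ i) (inj₂ j) _ = refl
sidewise-forward π ρ (inj₂ j) (inj₁ i) ()

swapLeft : ∀ {m n} → Fin m → Fin m → Perm m n
swapLeft a b = sidewise (transpose a b) idₚ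

swapRight : ∀ {m n} → Fin n → Fin n → Perm m n
swapRight a b = sidewise idₚ (transpose a b)

swapLeft-nonIdentity : ∀ {m n} {a b : Fin m} → a ≢ b → ¬ IsIdentity (swapLeft {n = n} a b)
swapLeft-nonIdentity {a = a} {b} a≢b idt =
  a≢b (trans (sym (inj₁-injective (idt (inj₁ a)))) (transpose-moves a b))

swapRight-nonIdentity : ∀ {m n} {a b : Fin n} → a ≢ b → ¬ IsIdentity (swapRight {m} a b)
swapRight-nonIdentity {a = a} {b} a≢b idt =
  a≢b (trans (sym (inj₂-injective (idt (inj₂ a)))) (transpose-moves a b))

-- In a distinguishing vertex-labelling of the forward orientation, two vertices of the
-- same part get different labels: otherwise swapping them preserves all labels.
module _ {m n r : ℕ} {c : V m n → Fin r} (vd : VDist forward c) where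

  forward-leftInjective : ∀ {a b} → c (inj₁ a) ≡ c (inj₁ b) → a ≡ b
  forward-leftInjective {a} {b} e with a F.≟ b
  ... | yes a≡b = a≡b
  ... | no a≢b = ⊥-elim (swapLeft-nonIdentity a≢b (vd (swapLeft a b) (sidewise-forward (transpose a b) idₚ) preserved))
    where
    preserved : ∀ u → c (app (swapLeft a b) u) ≡ c u
    preserved (inj₁ i) = transpose-invariant (λ x → c (inj₁ x)) e i
    preserved (inj₂ j) = refl

  forward-rightInjective : ∀ {a b} → c (inj₂ a) ≡ c (inj₂ b) → a ≡ b
  forward-rightInjective {a} {b} e with a F.≟ b
  ... | yes a≡b = a≡b
  ... | no a≢b = ⊥-elim (swapRight-nonIdentity a≢b (vd (swapRight a b) (sidewise-forward idₚ (transpose a b)) preserved))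
    where
    preserved : ∀ u → c (app (swapRight a b) u) ≡ c u
    preserved (inj₁ i) = refl
    preserved (inj₂ j) = transpose-invariant (λ x → c (inj₂ x)) e j

  -- If moreover c is proper, it is injective: an arc joins any left and right vertex.
  forward-injective : ProperVCol forward c → ∀ u v → c u ≡ c v → u ≡ v
  forward-injective pr (inj₁ a) (inj₁ b) e = cong inj₁ (forward-leftInjective e)
  forward-injective pr (inj₂ a) (inj₂ b) e = cong inj₂ (forward-rightInjective e)
  forward-injective pr (inj₁ a) (inj₂ b) e = ⊥-elim (pr (inj₁ a) (inj₂ b) refl e)
  forward-injective pr (inj₂ a) (inj₁ b) e = ⊥-elim (pr (inj₁ b) (inj₂ a) refl (sym e))

-- In a distinguishing edge-labelling of K_{m,n}, two right vertices see different
-- columns of labels: otherwise swapping them preserves all labels.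
UDist-columns : ∀ {m n r} {ℓ : EdgeLab m n r} → UDist ℓ → ∀ {a b} → (∀ i → ℓ i a ≡ ℓ i b) → a ≡ b
UDist-columns {m} {n} {ℓ = ℓ} ud {a} {b} sameColumn with a F.≟ b
... | yes a≡b = a≡b
... | no a≢b = ⊥-elim (swapRight-nonIdentity a≢b (ud (swapRight a b) swapAut preserved))
  where
  swapAut : IsUAut (swapRight {m} a b)
  swapAut = oaut⇒uaut forward (swapRight a b) (sidewise-forward idₚ (transpose a b))
  preserved : ∀ u v → Edge u v → lab ℓ (app (swapRight a b) u) (app (swapRight a b) v) ≡ lab ℓ u v
  preserved (inj₁ i) (inj₂ j) _ = cong just (transpose-invariant (ℓ i) (sameColumn i) j)
  preserved (inj₂ j) (inj₁ i) _ = cong just (transpose-invariant (ℓ i) (sameColumn i) j)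

V-pigeonhole : ∀ {m n r} → r < m + n → (c : V m n → Fin r) → ¬ (∀ u v → c u ≡ c v → u ≡ v)
V-pigeonhole {m} {n} r<m+n c c-inj with FP.pigeonhole r<m+n (λ x → c (F.splitAt m x))
... | x , y , x<y , e = FP.<⇒≢ x<y (begin
  x                               ≡⟨ FP.join-splitAt m n x ⟨
  F.join m n (F.splitAt m x)      ≡⟨ cong (F.join m n) (c-inj _ _ e) ⟩
  F.join m n (F.splitAt m y)      ≡⟨ FP.join-splitAt m n y ⟩
  y                               ∎)
  where open ≡-Reasoning

forward-D-lower : ∀ {m n r} → r < n → ¬ HasD (forward {m} {n}) r
forward-D-lower r<n (c , vd) with FP.pigeonhole r<n (λ j → c (inj₂ j))
... | a , b , a<b , e = FP.<⇒≢ a<b (forward-rightInjective vd e)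

forward-χD-lower : ∀ {m n r} → r < m + n → ¬ HasχD (forward {m} {n}) r
forward-χD-lower r<m+n (c , pr , vd) = V-pigeonhole r<m+n c (forward-injective vd pr)

arc-irreflexive : ∀ {m n} (o : Orientation m n) u → ¬ Arc o u u
arc-irreflexive o (inj₁ _) ()
arc-irreflexive o (inj₂ _) ()

join-injective : ∀ {m n} {u v : V m n} → F.join m n u ≡ F.join m n v → u ≡ v
join-injective {m} {n} {u} {v} e =
  trans (sym (FP.splitAt-join m n u)) (trans (cong (F.splitAt m) e) (FP.splitAt-join m n v))

-- n labels distinguish every orientation (m < n): label each part injectively,
-- then σ and τ must fix every label.
D-upper : ∀ {m n} → m < n → (o : Orientation m n) → HasD o n
D-upper {m} {n} m<n o = c , distinguishing
  where
  c : V m n → Fin n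
  c (inj₁ i) = F.inject≤ i (<⇒≤ m<n)
  c (inj₂ j) = j
  distinguishing : VDist o c
  distinguishing φ aut pres = identity
    (λ i → FP.inject≤-injective _ _ _ _ (trans (cong c (sym (φ-left i))) (pres (inj₁ i))))
    (λ j → trans (cong c (sym (φ-right j))) (pres (inj₂ j)))
    where open OrientedSides m<n o φ aut

χD-upper : ∀ {m n} (o : Orientation m n) → HasχD o (m + n)
χD-upper {m} {n} o =
  F.join m n ,
  (λ u v a e → arc-irreflexive o u (subst (Arc o u) (sym (join-injective e)) a)) ,
  (λ φ _ pres u → join-injective (pres u))

module Cyclic {m n : ℕ} (m<n : suc m < suc n) where

  infix 4 _≋_
  _≋_ : ℕ → ℕ → Set
  a ≋ b = a % suc n ≡ b % suc n

  ≋-+ʳ : ∀ a b c → a ≋ b → a + c ≋ b + c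
  ≋-+ʳ a b c e = begin
    (a + c) % suc n                          ≡⟨ %-distribˡ-+ a c (suc n) ⟩
    (a % suc n + c % suc n) % suc n          ≡⟨ cong (λ x → (x + c % suc n) % suc n) e ⟩
    (b % suc n + c % suc n) % suc n          ≡⟨ %-distribˡ-+ b c (suc n) ⟨
    (b + c) % suc n                          ∎
    where open ≡-Reasoning

  ≋-+ˡ : ∀ a b c → a ≋ b → c + a ≋ c + b
  ≋-+ˡ a b c e = subst₂ _≋_ (+-comm a c) (+-comm b c) (≋-+ʳ a b c e)

  -- Adding c is invertible modulo suc n: add c * n, so that c + c * n ≡ c * suc n.
  ≋-cancelʳ : ∀ a b c → a + c ≋ b + c → a ≋ b
  ≋-cancelʳ a b c e = begin
    a % suc n                     ≡⟨ [m+kn]%n≡m%n a c (suc n) ⟨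
    (a + c * suc n) % suc n       ≡⟨ cong (_% suc n) (rearrange a) ⟩
    (a + c + c * n) % suc n       ≡⟨ ≋-+ʳ (a + c) (b + c) (c * n) e ⟩
    (b + c + c * n) % suc n       ≡⟨ cong (_% suc n) (rearrange b) ⟨
    (b + c * suc n) % suc n       ≡⟨ [m+kn]%n≡m%n b c (suc n) ⟩
    b % suc n                     ∎
    where
    open ≡-Reasoning
    rearrange : ∀ x → x + c * suc n ≡ x + c + c * n
    rearrange x = trans (cong (x +_) (*-suc c n)) (sym (+-assoc x c (c * n)))

  ≋-small : ∀ {a b} → a < suc n → b < suc n → a ≋ b → a ≡ b
  ≋-small a<n b<n e = trans (sym (m<n⇒m%n≡m a<n)) (trans e (m<n⇒m%n≡m b<n))

  left<n : (i : Fin (suc m)) → toℕ i < suc n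
  left<n i = <-trans (FP.toℕ<n i) m<n

  cyc : EdgeLab (suc m) (suc n) (suc n)
  cyc i j = fromℕ< (m%n<n (toℕ i + toℕ j) (suc n))

  cyc-≋ : ∀ i j i' j' → cyc i j ≡ cyc i' j' → toℕ i + toℕ j ≋ toℕ i' + toℕ j'
  cyc-≋ i j i' j' e =
    trans (sym (FP.toℕ-fromℕ< _)) (trans (cong toℕ e) (FP.toℕ-fromℕ< _))

  cyc-proper : ProperEdgeCol cyc
  cyc-proper = row , column
    where
    row : ∀ i j j' → j ≢ j' → cyc i j ≢ cyc i j'
    row i j j' j≢j' e = j≢j' (FP.toℕ-injective (≋-small (FP.toℕ<n j) (FP.toℕ<n j')
      (≋-cancelʳ (toℕ j) (toℕ j') (toℕ i)
        (subst₂ _≋_ (+-comm (toℕ i) (toℕ j)) (+-comm (toℕ i) (toℕ j')) (cyc-≋ i j i j' e)))))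
    column : ∀ i i' j → i ≢ i' → cyc i j ≢ cyc i' j
    column i i' j i≢i' e =
      i≢i' (FP.toℕ-injective (≋-small (left<n i) (left<n i') (≋-cancelʳ (toℕ i) (toℕ i') (toℕ j) (cyc-≋ i j i' j e))))

  -- A self-map of Fin (suc m) acting as translation by s modulo suc n > suc m
  -- must be the identity translation: otherwise i = suc m ∸ s is sent to suc m.
  no-translation : (σ : Fin (suc m) → Fin (suc m)) (s : ℕ) → s < suc m →
                   (∀ i → toℕ (σ i) ≋ toℕ i + s) → s ≡ 0
  no-translation σ zero s<m shift = refl
  no-translation σ (suc s) s<m shift = ⊥-elim (<-irrefl σi≡m (FP.toℕ<n (σ i)))
    where
    i : Fin (suc m)
    i = fromℕ< (∸-monoʳ-< {suc m} {suc s} {0} (s≤s z≤n) (<⇒≤ s<m))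
    σi≡m : toℕ (σ i) ≡ suc m
    σi≡m = ≋-small (left<n (σ i)) m<n (trans (shift i)
      (cong (_% suc n) (trans (cong (_+ suc s) (FP.toℕ-fromℕ< _)) (m∸n+n≡m (<⇒≤ s<m)))))

  cyc-rigid : (σ : Fin (suc m) → Fin (suc m)) (τ : Fin (suc n) → Fin (suc n)) →
              (∀ i j → cyc (σ i) (τ j) ≡ cyc i j) → (∀ i → σ i ≡ i) × (∀ j → τ j ≡ j)
  cyc-rigid σ τ pres = σ-id , τ-id
    where
    s t : ℕ
    s = toℕ (σ zero)
    t = toℕ (τ zero)
    -- σ is translation by s: compare the labels of (i, 0) and (0, 0).
    shift : ∀ i → toℕ (σ i) ≋ toℕ i + s
    shift i = ≋-cancelʳ (toℕ (σ i)) (toℕ i + s) t (begin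
      (toℕ (σ i) + t) % suc n        ≡⟨ cyc-≋ (σ i) (τ zero) i zero (pres i zero) ⟩
      (toℕ i + 0) % suc n            ≡⟨ ≋-+ˡ (s + t) 0 (toℕ i) (cyc-≋ (σ zero) (τ zero) zero zero (pres zero zero)) ⟨
      (toℕ i + (s + t)) % suc n      ≡⟨ cong (_% suc n) (+-assoc (toℕ i) s t) ⟨
      (toℕ i + s + t) % suc n        ∎)
      where open ≡-Reasoning
    s≡0 : s ≡ 0
    s≡0 = no-translation σ s (FP.toℕ<n (σ zero)) shift
    σ-id : ∀ i → σ i ≡ i
    σ-id i = FP.toℕ-injective (≋-small (left<n (σ i)) (left<n i)
      (trans (shift i) (cong (_% suc n) (trans (cong (toℕ i +_) s≡0) (+-identityʳ (toℕ i))))))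
    τ-id : ∀ j → τ j ≡ j
    τ-id j = FP.toℕ-injective (≋-small (FP.toℕ<n (τ j)) (FP.toℕ<n j)
      (subst (λ x → x + toℕ (τ j) ≋ toℕ j) s≡0 (cyc-≋ (σ zero) (τ j) zero j (pres zero j))))

-- Upwards, σ i ≥ i since σ climbs at least one step at a time; downwards, σ i ≤ i
-- since σ of the top element is at most the top and σ descends at least one step at a time.
strictlyIncreasing⇒id : ∀ {k} (σ : Fin (suc k) → Fin (suc k)) →
                        (∀ i i' → i F.< i' → σ i F.< σ i') → ∀ i → σ i ≡ i
strictlyIncreasing⇒id {k} σ increasing i = FP.toℕ-injective (≤-antisym (atMost i) (atLeast i))
  where
  step : ∀ i → toℕ (σ (F.inject₁ i)) < toℕ (σ (suc i))
  step i = increasing (F.inject₁ i) (suc i) (s≤s (≤-reflexive (FP.toℕ-inject₁ i)))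
  atLeast : ∀ i → toℕ i ≤ toℕ (σ i)
  atLeast = FPI.<-weakInduction (λ i → toℕ i ≤ toℕ (σ i)) z≤n
    λ i ih → ≤-trans (s≤s (subst (_≤ toℕ (σ (F.inject₁ i))) (FP.toℕ-inject₁ i) ih)) (step i)
  atMost : ∀ i → toℕ (σ i) ≤ toℕ i
  atMost = FPI.>-weakInduction (λ i → toℕ (σ i) ≤ toℕ i)
    (subst (toℕ (σ (F.fromℕ k)) ≤_) (sym (FP.toℕ-fromℕ k)) (FP.toℕ≤pred[n] (σ (F.fromℕ k))))
    λ i ih → subst (toℕ (σ (F.inject₁ i)) ≤_) (sym (FP.toℕ-inject₁ i)) (≤-pred (≤-trans (step i) ih))

≤ᵇ≡true⇒≤ : ∀ {a b} → (a ≤ᵇ b) ≡ true → a ≤ b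
≤ᵇ≡true⇒≤ {a} {b} e = ≤ᵇ⇒≤ a b (subst T (sym e) tt)

≤⇒≤ᵇ≡true : ∀ {a b} → a ≤ b → (a ≤ᵇ b) ≡ true
≤⇒≤ᵇ≡true a≤b = Equivalence.to T-≡ (≤⇒≤ᵇ a≤b)

≤ᵇ≡false⇒> : ∀ {a b} → (a ≤ᵇ b) ≡ false → b < a
≤ᵇ≡false⇒> e = ≰⇒> λ a≤b → subst T e (≤⇒≤ᵇ a≤b)

>⇒≤ᵇ≡false : ∀ {a b} → b < a → (a ≤ᵇ b) ≡ false
>⇒≤ᵇ≡false {a} {b} b<a with a ≤ᵇ b in e
... | false = refl
... | true = ⊥-elim (<⇒≱ b<a (≤ᵇ≡true⇒≤ e))

-- Let the left part have m = suc p vertices, p = suc q ≥ 1,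
-- and write a right vertex j as residue j + block j * p.  Orient the edge ij from i to j
-- iff i ≤ residue j.  The out-neighbourhoods of the left vertices then form a strictly
-- decreasing chain, so every automorphism fixes the left part, and then each right vertex
-- keeps its in-neighbourhood, hence its residue.  Colouring the right vertices by their
-- block (there are ⌈(n + 1)/p⌉ blocks) therefore leaves only the identity.
module Staircase (q n : ℕ) (m<n : suc (suc q) < suc n) where

  p : ℕ
  p = suc q

  residue block : Fin (suc n) → ℕ
  residue j = toℕ j % p
  block j = toℕ j / p

  staircase : Orientation (suc p) (suc n)
  staircase i j = toℕ i ≤ᵇ residue j

  vertexWithResidue : ∀ x → x < p → Σ (Fin (suc n)) λ j → residue j ≡ x
  vertexWithResidue x x<p =
    fromℕ< x<n , trans (cong (_% p) (FP.toℕ-fromℕ< x<n)) (m<n⇒m%n≡m x<p)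
    where
    x<n : x < suc n
    x<n = <-trans x<p (<-trans (n<1+n p) m<n)

  residue-block-injective : ∀ {j j'} → residue j ≡ residue j' → block j ≡ block j' → j ≡ j'
  residue-block-injective {j} {j'} r b = FP.toℕ-injective (begin
    toℕ j                       ≡⟨ m≡m%n+[m/n]*n (toℕ j) p ⟩
    residue j + block j * p     ≡⟨ cong₂ (λ x y → x + y * p) r b ⟩
    residue j' + block j' * p   ≡⟨ m≡m%n+[m/n]*n (toℕ j') p ⟨
    toℕ j'                      ∎)
    where open ≡-Reasoning

  -- The in-neighbourhood of j is {i : i ≤ residue j}, so it determines residue j.
  residue-≤ : ∀ {j j'} → (∀ i → staircase i j ≡ staircase i j') → residue j ≤ residue j'
  residue-≤ {j} {j'} same = subst (_≤ residue j') toℕ-i (≤ᵇ≡true⇒≤ (trans (sym (same i)) fromI))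
    where
    r<m : residue j < suc p
    r<m = <-trans (m%n<n (toℕ j) p) (n<1+n p)
    i : Fin (suc p)
    i = fromℕ< r<m
    toℕ-i : toℕ i ≡ residue j
    toℕ-i = FP.toℕ-fromℕ< r<m
    fromI : staircase i j ≡ true
    fromI = ≤⇒≤ᵇ≡true (≤-reflexive toℕ-i)

  module Automorphism (φ : Perm (suc p) (suc n)) (aut : IsOAut staircase φ) where
    open OrientedSides m<n staircase φ aut public

    -- For i < i', a right vertex j of residue i receives an arc from i but not from i';
    -- so τ j receives an arc from σ i but not from σ i', i.e. σ i ≤ residue (τ j) < σ i'.
    σ-increasing : ∀ i i' → i F.< i' → σ i F.< σ i'
    σ-increasing i i' i<i' = ≤-<-trans (≤ᵇ≡true⇒≤ arcFromσi) (≤ᵇ≡false⇒> noArcFromσi')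
      where
      i<p : toℕ i < p
      i<p = <-≤-trans i<i' (≤-pred (FP.toℕ<n i'))
      j : Fin (suc n)
      j = proj₁ (vertexWithResidue (toℕ i) i<p)
      residue-j : residue j ≡ toℕ i
      residue-j = proj₂ (vertexWithResidue (toℕ i) i<p)
      arcFromσi : staircase (σ i) (τ j) ≡ true
      arcFromσi = trans (direction i j) (≤⇒≤ᵇ≡true (≤-reflexive (sym residue-j)))
      noArcFromσi' : staircase (σ i') (τ j) ≡ false
      noArcFromσi' = trans (direction i' j) (>⇒≤ᵇ≡false (subst (_< toℕ i') (sym residue-j) i<i'))

    σ-id : ∀ i → σ i ≡ i
    σ-id = strictlyIncreasing⇒id σ σ-increasing

    -- With σ the identity, τ j has the in-neighbourhood, hence the residue, of j.
    τ-residue : ∀ j → residue (τ j) ≡ residue j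
    τ-residue j = ≤-antisym (residue-≤ {τ j} {j} same) (residue-≤ {j} {τ j} (λ i → sym (same i)))
      where
      same : ∀ i → staircase i (τ j) ≡ staircase i j
      same i = trans (cong (λ x → staircase x (τ j)) (sym (σ-id i))) (direction i j)

    trivial : (∀ j → block (τ j) ≡ block j) → IsIdentity φ
    trivial τ-block = identity σ-id (λ j → residue-block-injective {τ j} {j} (τ-residue j) (τ-block j))

  blocks : ℕ
  blocks = ceilDivPred (suc n) (suc p)

  blocks≡ : blocks ≡ suc (n / p)
  blocks≡ = trans (m/n≡1+[m∸n]/n {suc n + q} {p} (s≤s (m≤n+m q n))) (cong (λ x → suc (x / p)) (m+n∸n≡m n q))

  2≤blocks : 2 ≤ blocks
  2≤blocks = subst (2 ≤_) (sym blocks≡) (s≤s (m≥n⇒m/n>0 {n} {p} (≤-trans (n≤1+n p) (≤-pred m<n))))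

  blockOf : Fin (suc n) → Fin blocks
  blockOf j = fromℕ< (subst (block j <_) (sym blocks≡) (s≤s (/-monoˡ-≤ p (≤-pred (FP.toℕ<n j)))))

  blockOf-injective : ∀ j j' → blockOf j ≡ blockOf j' → block j ≡ block j'
  blockOf-injective j j' e = trans (sym (FP.toℕ-fromℕ< _)) (trans (cong toℕ e) (FP.toℕ-fromℕ< _))

  staircase-D : HasD staircase blocks
  staircase-D = colour , distinguishing
    where
    colour : V (suc p) (suc n) → Fin blocks
    colour (inj₁ _) = blockOf zero
    colour (inj₂ j) = blockOf j
    distinguishing : VDist staircase colour
    distinguishing φ aut pres =
      trivial (λ j → blockOf-injective (τ j) j (trans (cong colour (sym (φ-right j))) (pres (inj₂ j))))
      where open Automorphism φ aut

  staircase-χD : HasχD staircase (suc blocks)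
  staircase-χD = colour , proper , distinguishing
    where
    colour : V (suc p) (suc n) → Fin (suc blocks)
    colour (inj₁ _) = F.fromℕ blocks
    colour (inj₂ j) = F.inject₁ (blockOf j)
    proper : ProperVCol staircase colour
    proper (inj₁ i) (inj₂ j) _ e = FP.fromℕ≢inject₁ e
    proper (inj₂ j) (inj₁ i) _ e = FP.fromℕ≢inject₁ (sym e)
    distinguishing : VDist staircase colour
    distinguishing φ aut pres = trivial (λ j → blockOf-injective (τ j) j
      (FP.inject₁-injective (trans (cong colour (sym (φ-right j))) (pres (inj₂ j)))))
      where open Automorphism φ aut

  -- Pulling back a distinguishing edge-labelling ℓ' of K_{m,blocks} along the block map
  -- distinguishes the staircase: preserved labels force equal columns of ℓ', i.e. equal blocks.
  staircase-D' : ∀ {k} → HasUD' (suc p) blocks k → HasD' staircase k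
  staircase-D' {k} (ℓ' , ud) = ℓ , distinguishing
    where
    ℓ : EdgeLab (suc p) (suc n) k
    ℓ i j = ℓ' i (blockOf j)
    distinguishing : ADist staircase ℓ
    distinguishing φ aut pres = trivial (λ j → blockOf-injective (τ j) j (UDist-columns ud (λ i →
      trans (cong (λ x → ℓ' x (blockOf (τ j))) (sym (σ-id i))) (arcLabels ℓ pres i j))))
      where open Automorphism φ aut

-- Giving the edges of K_{a,b} pairwise distinct labels is distinguishing as soon as both
-- parts have two vertices: a label-preserving φ maps each edge to itself (possibly
-- reversed), and a vertex on two edges which are both fixed setwise must be fixed.
distinctLabels : ∀ {a b} → 2 ≤ a → 2 ≤ b → HasUD' a b (a * b)
distinctLabels {a} {b} (s≤s (s≤s _)) (s≤s (s≤s _)) = ℓ , distinguishing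
  where
  ℓ : EdgeLab a b (a * b)
  ℓ = F.combine

  ends : ∀ i j x y → lab ℓ x y ≡ just (ℓ i j) → (x ≡ inj₁ i × y ≡ inj₂ j) ⊎ (x ≡ inj₂ j × y ≡ inj₁ i)
  ends i j (inj₁ i') (inj₂ j') e with FP.combine-injective i' j' i j (MP.just-injective e)
  ... | refl , refl = inj₁ (refl , refl)
  ends i j (inj₂ j') (inj₁ i') e with FP.combine-injective i' j' i j (MP.just-injective e)
  ... | refl , refl = inj₂ (refl , refl)

  distinguishing : UDist ℓ
  distinguishing φ _ pres = fixed
    where
    image : ∀ i j → (app φ (inj₁ i) ≡ inj₁ i × app φ (inj₂ j) ≡ inj₂ j) ⊎
                    (app φ (inj₁ i) ≡ inj₂ j × app φ (inj₂ j) ≡ inj₁ i)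
    image i j = ends i j _ _ (pres (inj₁ i) (inj₂ j) tt)
    fixed : IsIdentity φ
    fixed (inj₁ i) with image i zero | image i (suc zero)
    ... | inj₁ (e , _) | _ = e
    ... | inj₂ (e , _) | inj₁ (e' , _) with () ← trans (sym e) e'
    ... | inj₂ (e , _) | inj₂ (e' , _) = ⊥-elim (FP.0≢1+n (inj₂-injective (trans (sym e) e')))
    fixed (inj₂ j) with image zero j | image (suc zero) j
    ... | inj₁ (_ , e) | _ = e
    ... | inj₂ (_ , e) | inj₁ (_ , e') with () ← trans (sym e) e'
    ... | inj₂ (_ , e) | inj₂ (_ , e') = ⊥-elim (FP.0≢1+n (inj₁-injective (trans (sym e) e')))

-- Exhaustive search makes "admits a distinguishing labelling with r labels"
-- decidable, which is what gives least values their existence.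
Exhaustible : Set → Set₁
Exhaustible A = ∀ {P : A → Set} → (∀ a → Dec (P a)) → Dec (Σ A P)

exhaustible-Fin : ∀ k → Exhaustible (Fin k)
exhaustible-Fin k P? = FP.any? P?

exhaustible-⊎ : ∀ {A B} → Exhaustible A → Exhaustible B → Exhaustible (A ⊎ B)
exhaustible-⊎ exA exB P? with exA (λ a → P? (inj₁ a)) | exB (λ b → P? (inj₂ b))
... | yes (a , pa) | _ = yes (inj₁ a , pa)
... | no _ | yes (b , pb) = yes (inj₂ b , pb)
... | no ¬a | no ¬b = no λ { (inj₁ a , pa) → ¬a (a , pa) ; (inj₂ b , pb) → ¬b (b , pb) }

exhaustible-× : ∀ {A B} → Exhaustible A → Exhaustible B → Exhaustible (A × B)
exhaustible-× exA exB P? =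
  map′ (λ (a , b , p) → (a , b) , p) (λ ((a , b) , p) → a , b , p) (exA λ a → exB λ b → P? (a , b))

exhaustible-Vec : ∀ {A} → Exhaustible A → ∀ k → Exhaustible (Vec A k)
exhaustible-Vec exA zero P? = map′ (λ p → [] , p) (λ { ([] , p) → p }) (P? [])
exhaustible-Vec exA (suc k) P? = map′ (λ (x , xs , p) → x ∷ xs , p) (λ { (x ∷ xs , p) → x , xs , p })
  (exA λ x → exhaustible-Vec exA k λ xs → P? (x ∷ xs))

exhaustible-V : ∀ {m n} → Exhaustible (V m n)
exhaustible-V {m} {n} = exhaustible-⊎ (exhaustible-Fin m) (exhaustible-Fin n)

decide-∀ : ∀ {A} {P : A → Set} → Exhaustible A → (∀ a → Dec (P a)) → Dec (∀ a → P a)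
decide-∀ exA P? with exA (λ a → ¬? (P? a))
... | yes (a , ¬pa) = no λ all → ¬pa (all a)
... | no none = yes λ a → decidable-stable (P? a) (λ ¬pa → none (a , ¬pa))

searchByCode : ∀ {C T : Set} {_≈_ : T → T → Set} → Exhaustible C →
               (decode : C → T) (encode : T → C) → (∀ t → t ≈ decode (encode t)) →
               ∀ {P : T → Set} → (∀ {s t} → s ≈ t → P s → P t) → (∀ t → Dec (P t)) → Dec (Σ T P)
searchByCode exC decode encode roundTrip resp P? =
  map′ (λ (c , p) → decode c , p) (λ (t , p) → encode t , resp (roundTrip t) p) (exC λ c → P? (decode c))

VCode : ℕ → ℕ → Set → Set
VCode m n X = Vec X m × Vec X n

decodeV : ∀ {m n X} → VCode m n X → V m n → X
decodeV (xs , ys) = Sum.[ lookup xs , lookup ys ]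

encodeV : ∀ {m n X} → (V m n → X) → VCode m n X
encodeV f = tabulate (λ i → f (inj₁ i)) , tabulate (λ j → f (inj₂ j))

decodeV-encodeV : ∀ {m n X} (f : V m n → X) u → f u ≡ decodeV (encodeV f) u
decodeV-encodeV f (inj₁ i) = sym (lookup∘tabulate (λ i → f (inj₁ i)) i)
decodeV-encodeV f (inj₂ j) = sym (lookup∘tabulate (λ j → f (inj₂ j)) j)

exhaustible-VCode : ∀ {m n X} → Exhaustible X → Exhaustible (VCode m n X)
exhaustible-VCode {m} {n} exX = exhaustible-× (exhaustible-Vec exX m) (exhaustible-Vec exX n)

decodeLab : ∀ {m n r} → Vec (Vec (Fin r) n) m → EdgeLab m n r
decodeLab rows i j = lookup (lookup rows i) j

encodeLab : ∀ {m n r} → EdgeLab m n r → Vec (Vec (Fin r) n) m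
encodeLab ℓ = tabulate (λ i → tabulate (ℓ i))

decodeLab-encodeLab : ∀ {m n r} (ℓ : EdgeLab m n r) i j → ℓ i j ≡ decodeLab (encodeLab ℓ) i j
decodeLab-encodeLab ℓ i j =
  sym (trans (cong (λ row → lookup row j) (lookup∘tabulate (λ i → tabulate (ℓ i)) i)) (lookup∘tabulate (ℓ i) j))

module MapProperties {m n : ℕ} where

  Map : Set
  Map = V m n → V m n

  Extensional : (Map → Set) → Set
  Extensional Q = ∀ {f g} → (∀ u → f u ≡ g u) → Q f → Q g

  -- A statement about all permutations of V m n is decided through pairs of codes
  -- of mutually inverse maps.
  decide-∀Perm : ∀ {Q : Map → Set} → Extensional Q → (∀ f → Dec (Q f)) → Dec (∀ (φ : Perm m n) → Q (app φ))
  decide-∀Perm {Q} ext Q? = map′ fromCodes toCodes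
    (decide-∀ (exhaustible-× (exhaustible-VCode exhaustible-V) (exhaustible-VCode exhaustible-V))
      λ (F , G) → inverses? (decodeV F) (decodeV G) →-dec Q? (decodeV F))
    where
    Inverses : Map → Map → Set
    Inverses f g = (∀ v → f (g v) ≡ v) × (∀ u → g (f u) ≡ u)
    inverses? : ∀ f g → Dec (Inverses f g)
    inverses? f g = decide-∀ exhaustible-V (λ v → SP.≡-dec F._≟_ F._≟_ (f (g v)) v)
              ×-dec decide-∀ exhaustible-V (λ u → SP.≡-dec F._≟_ F._≟_ (g (f u)) u)
    fromCodes : (∀ c → Inverses (decodeV (proj₁ c)) (decodeV (proj₂ c)) → Q (decodeV (proj₁ c))) →
                ∀ φ → Q (app φ)
    fromCodes all φ = ext (λ u → sym (to≗ u)) (all (encodeV to , encodeV from) (inv₁ , inv₂))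
      where
      to from : Map
      to = Inverse.to φ
      from = Inverse.from φ
      to≗ : ∀ u → to u ≡ decodeV (encodeV to) u
      to≗ = decodeV-encodeV to
      from≗ : ∀ u → from u ≡ decodeV (encodeV from) u
      from≗ = decodeV-encodeV from
      inv₁ : ∀ v → decodeV (encodeV to) (decodeV (encodeV from) v) ≡ v
      inv₁ v = trans (sym (to≗ _)) (trans (cong to (sym (from≗ v))) (Inverse.strictlyInverseˡ φ v))
      inv₂ : ∀ u → decodeV (encodeV from) (decodeV (encodeV to) u) ≡ u
      inv₂ u = trans (sym (from≗ _)) (trans (cong from (sym (to≗ u))) (Inverse.strictlyInverseʳ φ u))
    toCodes : (∀ φ → Q (app φ)) →
              ∀ c → Inverses (decodeV (proj₁ c)) (decodeV (proj₂ c)) → Q (decodeV (proj₁ c))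
    toCodes all (F , G) (inv₁ , inv₂) = all (mk↔ₛ′ (decodeV F) (decodeV G) inv₁ inv₂)

  ext-→ : ∀ {A B : Map → Set} → Extensional A → Extensional B → Extensional (λ f → A f → B f)
  ext-→ extA extB f≗g h a = extB f≗g (h (extA (λ u → sym (f≗g u)) a))

  PreservesRel : (V m n → V m n → Set) → Map → Set
  PreservesRel R f = ∀ u v → R u v → R (f u) (f v)

  PreservesColours : ∀ {r} → (V m n → Fin r) → Map → Set
  PreservesColours c f = ∀ u → c (f u) ≡ c u

  PreservesLabels : ∀ {r} → (V m n → V m n → Set) → EdgeLab m n r → Map → Set
  PreservesLabels R ℓ f = ∀ u v → R u v → lab ℓ (f u) (f v) ≡ lab ℓ u v

  Fixes : Map → Set
  Fixes f = ∀ u → f u ≡ u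

  ext-rel : ∀ R → Extensional (PreservesRel R)
  ext-rel R f≗g pres u v a = subst₂ R (f≗g u) (f≗g v) (pres u v a)

  ext-colours : ∀ {r} (c : V m n → Fin r) → Extensional (PreservesColours c)
  ext-colours c f≗g pres u = trans (cong c (sym (f≗g u))) (pres u)

  ext-labels : ∀ {r} R (ℓ : EdgeLab m n r) → Extensional (PreservesLabels R ℓ)
  ext-labels R ℓ f≗g pres u v a = trans (cong₂ (lab ℓ) (sym (f≗g u)) (sym (f≗g v))) (pres u v a)

  ext-fixes : Extensional Fixes
  ext-fixes f≗g fixes u = trans (sym (f≗g u)) (fixes u)

  rel? : ∀ {R : V m n → V m n → Set} → (∀ u v → Dec (R u v)) → ∀ f → Dec (PreservesRel R f)
  rel? R? f = decide-∀ exhaustible-V λ u → decide-∀ exhaustible-V λ v → R? u v →-dec R? (f u) (f v)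

  colours? : ∀ {r} (c : V m n → Fin r) f → Dec (PreservesColours c f)
  colours? c f = decide-∀ exhaustible-V λ u → c (f u) F.≟ c u

  labels? : ∀ {r} {R : V m n → V m n → Set} → (∀ u v → Dec (R u v)) → (ℓ : EdgeLab m n r) →
            ∀ f → Dec (PreservesLabels R ℓ f)
  labels? R? ℓ f = decide-∀ exhaustible-V λ u → decide-∀ exhaustible-V λ v →
    R? u v →-dec MP.≡-dec F._≟_ (lab ℓ (f u) (f v)) (lab ℓ u v)

  fixes? : ∀ f → Dec (Fixes f)
  fixes? f = decide-∀ exhaustible-V λ u → SP.≡-dec F._≟_ F._≟_ (f u) u

  decide-rigid : ∀ {A B : Map → Set} → Extensional A → Extensional B → (∀ f → Dec (A f)) → (∀ f → Dec (B f)) →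
                 Dec (∀ (φ : Perm m n) → A (app φ) → B (app φ) → IsIdentity φ)
  decide-rigid extA extB A? B? =
    decide-∀Perm (ext-→ extA (ext-→ extB ext-fixes)) (λ f → A? f →-dec (B? f →-dec fixes? f))

open MapProperties

arc? : ∀ {m n} (o : Orientation m n) u v → Dec (Arc o u v)
arc? o (inj₁ i) (inj₂ j) = o i j BP.≟ true
arc? o (inj₂ j) (inj₁ i) = o i j BP.≟ false
arc? o (inj₁ _) (inj₁ _) = no λ ()
arc? o (inj₂ _) (inj₂ _) = no λ ()

edge? : ∀ {m n} (u v : V m n) → Dec (Edge u v)
edge? (inj₁ i) (inj₂ j) = yes tt
edge? (inj₂ j) (inj₁ i) = yes tt
edge? (inj₁ _) (inj₁ _) = no λ ()
edge? (inj₂ _) (inj₂ _) = no λ ()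

VDist? : ∀ {m n r} (o : Orientation m n) (c : V m n → Fin r) → Dec (VDist o c)
VDist? o c = decide-rigid (ext-rel (Arc o)) (ext-colours c) (rel? (arc? o)) (colours? c)

ADist? : ∀ {m n r} (o : Orientation m n) (ℓ : EdgeLab m n r) → Dec (ADist o ℓ)
ADist? o ℓ = decide-rigid (ext-rel (Arc o)) (ext-labels (Arc o) ℓ) (rel? (arc? o)) (labels? (arc? o) ℓ)

UDist? : ∀ {m n r} (ℓ : EdgeLab m n r) → Dec (UDist ℓ)
UDist? ℓ = decide-rigid (ext-rel Edge) (ext-labels Edge ℓ) (rel? edge?) (labels? edge? ℓ)

ProperVCol? : ∀ {m n r} (o : Orientation m n) (c : V m n → Fin r) → Dec (ProperVCol o c)
ProperVCol? o c = decide-∀ exhaustible-V λ u → decide-∀ exhaustible-V λ v → arc? o u v →-dec ¬? (c u F.≟ c v)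

VDist-ext : ∀ {m n r} (o : Orientation m n) {c c' : V m n → Fin r} → (∀ u → c u ≡ c' u) → VDist o c → VDist o c'
VDist-ext o c≗c' vd φ aut pres = vd φ aut λ u → trans (c≗c' (app φ u)) (trans (pres u) (sym (c≗c' u)))

ProperVCol-ext : ∀ {m n r} (o : Orientation m n) {c c' : V m n → Fin r} → (∀ u → c u ≡ c' u) →
                 ProperVCol o c → ProperVCol o c'
ProperVCol-ext o c≗c' pr u v a e = pr u v a (trans (c≗c' u) (trans e (sym (c≗c' v))))

lab-ext : ∀ {m n r} {ℓ ℓ' : EdgeLab m n r} → (∀ i j → ℓ i j ≡ ℓ' i j) → ∀ u v → lab ℓ u v ≡ lab ℓ' u v
lab-ext ℓ≗ℓ' (inj₁ i) (inj₂ j) = cong just (ℓ≗ℓ' i j)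
lab-ext ℓ≗ℓ' (inj₂ j) (inj₁ i) = cong just (ℓ≗ℓ' i j)
lab-ext ℓ≗ℓ' (inj₁ _) (inj₁ _) = refl
lab-ext ℓ≗ℓ' (inj₂ _) (inj₂ _) = refl

ADist-ext : ∀ {m n r} (o : Orientation m n) {ℓ ℓ' : EdgeLab m n r} → (∀ i j → ℓ i j ≡ ℓ' i j) → ADist o ℓ → ADist o ℓ'
ADist-ext o ℓ≗ℓ' ad φ aut pres =
  ad φ aut λ u v a → trans (lab-ext ℓ≗ℓ' _ _) (trans (pres u v a) (sym (lab-ext ℓ≗ℓ' u v)))

UDist-ext : ∀ {m n r} {ℓ ℓ' : EdgeLab m n r} → (∀ i j → ℓ i j ≡ ℓ' i j) → UDist ℓ → UDist ℓ'
UDist-ext ℓ≗ℓ' ud φ aut pres =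
  ud φ aut λ u v e → trans (lab-ext ℓ≗ℓ' _ _) (trans (pres u v e) (sym (lab-ext ℓ≗ℓ' u v)))

HasD? : ∀ {m n} (o : Orientation m n) r → Dec (HasD o r)
HasD? o r = searchByCode (exhaustible-VCode (exhaustible-Fin r)) decodeV encodeV decodeV-encodeV (VDist-ext o) (VDist? o)

HasχD? : ∀ {m n} (o : Orientation m n) r → Dec (HasχD o r)
HasχD? o r = searchByCode (exhaustible-VCode (exhaustible-Fin r)) decodeV encodeV decodeV-encodeV
  (λ c≗c' (pr , vd) → ProperVCol-ext o c≗c' pr , VDist-ext o c≗c' vd) (λ c → ProperVCol? o c ×-dec VDist? o c)

exhaustible-EdgeLabCode : ∀ {m n r} → Exhaustible (Vec (Vec (Fin r) n) m)
exhaustible-EdgeLabCode {m} {n} {r} = exhaustible-Vec (exhaustible-Vec (exhaustible-Fin r) n) m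

HasD'? : ∀ {m n} (o : Orientation m n) r → Dec (HasD' o r)
HasD'? o r = searchByCode exhaustible-EdgeLabCode decodeLab encodeLab decodeLab-encodeLab (ADist-ext o) (ADist? o)

HasUD'? : ∀ m n r → Dec (HasUD' m n r)
HasUD'? m n r = searchByCode exhaustible-EdgeLabCode decodeLab encodeLab decodeLab-encodeLab UDist-ext UDist?

least-exists : (P : ℕ → Set) → (∀ r → Dec (P r)) → ∀ {N} → P N → Σ ℕ (IsLeast P)
least-exists P P? {N} pN = search 0 N (λ _ ()) pN
  where
  -- Invariant: P fails below k and holds at k + d.
  search : ∀ k d → (∀ r → r < k → ¬ P r) → P (k + d) → Σ ℕ (IsLeast P)
  search k d below p with P? k
  ... | yes pk = k , pk , below
  search k zero below p | no ¬pk = ⊥-elim (¬pk (subst P (+-identityʳ k) p))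
  search k (suc d) below p | no ¬pk = search (suc k) d below' (subst P (+-suc k d) p)
    where
    below' : ∀ r → r < suc k → ¬ P r
    below' r r<1+k with m≤n⇒m<n∨m≡n (≤-pred r<1+k)
    ... | inj₁ r<k = below r r<k
    ... | inj₂ refl = ¬pk

least≤ : ∀ {P : ℕ → Set} {k k'} → IsLeast P k → P k' → k ≤ k'
least≤ (_ , below) pk' = ≮⇒≥ λ k'<k → below _ k'<k pk'

D'-exists : ∀ {a b} → 2 ≤ a → 2 ≤ b → Σ ℕ (IsLeast (HasUD' a b))
D'-exists {a} {b} 2≤a 2≤b = least-exists (HasUD' a b) (HasUD'? a b) (distinctLabels 2≤a 2≤b)

module _ {m n : ℕ} {P : Orientation m n → ℕ → Set} where

  maxOver : ∀ {k} (o₀ : Orientation m n) → IsLeast (P o₀) k → (∀ o → P o k) → MaxOver P k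
  maxOver o₀ least suffices = (o₀ , least) , λ o k' least' → least≤ least' (suffices o)

  minOver : ∀ {k} (o₀ : Orientation m n) → P o₀ k → (∀ o r → r < k → ¬ P o r) → MinOver P k
  minOver o₀ pk fewer = (o₀ , pk , fewer o₀) , λ o k' least' → ≮⇒≥ λ k'<k → fewer o k' k'<k (proj₁ least')

  minAtMost : ∀ {k} (o₀ : Orientation m n) → (∀ r → Dec (P o₀ r)) → P o₀ k → MinAtMost P k
  minAtMost o₀ P? pk with least-exists (P o₀) P? pk
  ... | k' , least = o₀ , k' , least , least≤ least pk

D-positive : ∀ {m n} (o : Orientation (suc m) n) r → r < 1 → ¬ HasD o r
D-positive o zero _ (c , _) with c (inj₁ zero)
... | ()
D-positive o (suc _) (s≤s ()) _

D'-positive : ∀ {m n} (o : Orientation (suc m) (suc n)) r → r < 1 → ¬ HasD' o r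
D'-positive o zero _ (ℓ , _) with ℓ zero zero
... | ()
D'-positive o (suc _) (s≤s ()) _

Fin1-unique : (a b : Fin 1) → a ≡ b
Fin1-unique zero zero = refl

χD-atLeast2 : ∀ {m n} (o : Orientation (suc m) (suc n)) r → r < 2 → ¬ HasχD o r
χD-atLeast2 o zero _ (c , _) with c (inj₁ zero)
... | ()
χD-atLeast2 o (suc zero) _ (c , proper , _) with edge⇒arc o (inj₁ zero) (inj₂ zero) tt
... | inj₁ a = proper (inj₁ zero) (inj₂ zero) a (Fin1-unique _ _)
... | inj₂ a = proper (inj₂ zero) (inj₁ zero) a (Fin1-unique _ _)
χD-atLeast2 o (suc (suc _)) (s≤s (s≤s ())) _

bipartition : ∀ {m n} → V m n → Fin 2
bipartition (inj₁ _) = zero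
bipartition (inj₂ _) = suc zero

bipartition-proper : ∀ {m n} (o : Orientation m n) → ProperVCol o bipartition
bipartition-proper o (inj₁ i) (inj₂ j) _ ()
bipartition-proper o (inj₂ j) (inj₁ i) _ ()

-- A proper arc-colouring needs n colours: the n arcs at a left vertex get distinct colours.
χ'D-lower : ∀ {m n r} (o : Orientation m n) → Fin m → r < n → ¬ Hasχ'D o r
χ'D-lower o i r<n (ℓ , (row , _) , _) with FP.pigeonhole r<n (ℓ i)
... | a , b , a<b , e = row i a b (FP.<⇒≢ a<b) e

χ'D-exact : ∀ {m n} (m<n : suc m < suc n) (o : Orientation (suc m) (suc n)) → IsLeast (Hasχ'D o) (suc n)
χ'D-exact m<n o = (cyc , cyc-proper , distinguishing) , λ r → χ'D-lower o zero
  where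
  open Cyclic m<n
  distinguishing : ADist o cyc
  distinguishing φ aut pres = identity (proj₁ fixed) (proj₂ fixed)
    where
    open OrientedSides m<n o φ aut
    fixed : (∀ i → σ i ≡ i) × (∀ j → τ j ≡ j)
    fixed = cyc-rigid σ τ (arcLabels cyc pres)

HasUD'⇒HasD' : ∀ {m n r} (o : Orientation m n) → HasUD' m n r → HasD' o r
HasUD'⇒HasD' o (ℓ , ud) = ℓ , UDist⇒ADist o ℓ ud

D'-forward-exact : ∀ {m n k} → m < n → IsLeast (HasUD' m n) k → IsLeast (HasD' forward) k
D'-forward-exact m<n (has , fewer) =
  HasUD'⇒HasD' forward has , λ r r<k (ℓ , ad) → fewer r r<k (ℓ , ADist-forward⇒UDist m<n ℓ ad)

D'-max : ∀ {m n} → m < n → Σ ℕ (IsLeast (HasUD' m n)) →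
         Σ ℕ (λ k → IsLeast (HasUD' m n) k × MaxOver {m} {n} HasD' k)
D'-max m<n (k , least) =
  k , least , maxOver forward (D'-forward-exact m<n least) (λ o → HasUD'⇒HasD' o (proj₁ least))

module Parts (q n' : ℕ) (m<n : suc (suc q) < suc (suc n')) where

  private
    m n : ℕ
    m = suc (suc q)
    n = suc (suc n')

  open Staircase q (suc n') m<n using (staircase; blocks; 2≤blocks; staircase-D; staircase-χD; staircase-D')

  2≤m : 2 ≤ m
  2≤m = s≤s (s≤s z≤n)

  2≤n : 2 ≤ n
  2≤n = s≤s (s≤s z≤n)

  maxima : MaxOver {m} {n} HasD n
         × MaxOver {m} {n} Hasχ'D n
         × Σ ℕ (λ k → IsLeast (HasUD' m n) k × MaxOver {m} {n} HasD' k)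
         × MaxOver {m} {n} HasχD (m + n)
  maxima =
      maxOver forward (D-upper m<n forward , λ _ → forward-D-lower) (D-upper m<n)
    , maxOver forward (χ'D-exact m<n forward) (λ o → proj₁ (χ'D-exact m<n o))
    , D'-max m<n (D'-exists 2≤m 2≤n)
    , maxOver forward (χD-upper forward , λ _ → forward-χD-lower) χD-upper

  χ'D-min : MinOver {m} {n} Hasχ'D n
  χ'D-min = minOver forward (proj₁ (χ'D-exact m<n forward)) (λ o → proj₂ (χ'D-exact m<n o))

  -- (2) For a rigid orientation every labelling is distinguishing.
  minimaIfRigid : Σ (Orientation m n) Rigid →
                  MinOver {m} {n} HasD 1 × MinOver {m} {n} HasD' 1 × MinOver {m} {n} HasχD 2 × MinOver {m} {n} Hasχ'D n
  minimaIfRigid (o , rigid) =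
      minOver o ((λ _ → zero) , λ φ aut _ → rigid φ aut) D-positive
    , minOver o ((λ _ _ → zero) , λ φ aut _ → rigid φ aut) D'-positive
    , minOver o (bipartition , bipartition-proper o , λ φ aut _ → rigid φ aut) χD-atLeast2
    , χ'D-min

  D'-bound : Σ ℕ (IsLeast (HasUD' m blocks)) → Σ ℕ (λ k → IsLeast (HasUD' m blocks) k × MinAtMost {m} {n} HasD' k)
  D'-bound (k , least) = k , least , minAtMost staircase (HasD'? staircase) (staircase-D' (proj₁ least))

  -- (3) The staircase orientation gives the upper bounds; they hold whether or not a rigid
  -- orientation exists.
  staircaseBounds : MinAtMost {m} {n} HasD blocks
                  × MinAtMost {m} {n} HasχD (1 + blocks)
                  × Σ ℕ (λ k → IsLeast (HasUD' m blocks) k × MinAtMost {m} {n} HasD' k)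
                  × MinOver {m} {n} Hasχ'D n
  staircaseBounds =
      minAtMost staircase (HasD? staircase) staircase-D
    , minAtMost staircase (HasχD? staircase) staircase-χD
    , D'-bound (D'-exists 2≤m 2≤blocks)
    , χ'D-min

theorem15 : (m n : ℕ) → 2 ≤ m → m < n →
    (MaxOver {m} {n} HasD n
      × MaxOver {m} {n} Hasχ'D n
      × Σ ℕ (λ k → IsLeast (HasUD' m n) k × MaxOver {m} {n} HasD' k)
      × MaxOver {m} {n} HasχD (m + n))
    × (Σ (Orientation m n) Rigid →
        MinOver {m} {n} HasD 1
        × MinOver {m} {n} HasD' 1
        × MinOver {m} {n} HasχD 2
        × MinOver {m} {n} Hasχ'D n)
    × (¬ Σ (Orientation m n) Rigid →
        MinAtMost {m} {n} HasD (ceilDivPred n m)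
        × MinAtMost {m} {n} HasχD (1 + ceilDivPred n m)
        × Σ ℕ (λ k → IsLeast (HasUD' m (ceilDivPred n m)) k × MinAtMost {m} {n} HasD' k)
        × MinOver {m} {n} Hasχ'D n)
theorem15 (suc (suc q)) (suc (suc n')) _ m<n = maxima , minimaIfRigid , λ _ → staircaseBounds
  where open Parts q n' m<n
theorem15 (suc (suc q)) (suc zero) _ (s≤s ())
theorem15 (suc (suc q)) zero _ ()
theorem15 (suc zero) _ (s≤s ()) _
theorem15 zero _ () _
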